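{- Let $A,B$ be sets. For $a\in A$ let $\eta(a):(A\to\mathbb{R}_l^+)\to\mathbb{R}_l^+$ be $\eta(a)(f)=f(a)$, and for $x:(A\to\mathbb{R}_l^+)\to\mathbb{R}_l^+$ and $y:A\to((B\to\mathbb{R}_l^+)\to\mathbb{R}_l^+)$ let $(x >\!\!>\!= y)(f) = x(a\mapsto y(a)(f))$ for $f:B\to\mathbb{R}_l^+$ (the unit and bind of the continuation monad with answer set $\mathbb{R}_l^+$). Then $\eta(a)\in\mathfrak{G}_{\le1}(A)\subseteq\mathfrak{G}(A)$ for all $a\in A$; if $\mathcal{I}\in\mathfrak{G}(A)$ and $\mathcal{J}:A\to\mathfrak{G}(B)$ then $\mathcal{I}>\!\!>\!=\mathcal{J}\in\mathfrak{G}(B)$; and if $\mathcal{I}\in\mathfrak{G}_{\le1}(A)$ and $\mathcal{J}:A\to\mathfrak{G}_{\le1}(B)$ then $\mathcal{I}>\!\!>\!=\mathcal{J}\in\mathfrak{G}_{\le1}(B)$. Consequently $A\mapsto\mathfrak{G}(A)$ and $A\mapsto\mathfrak{G}_{\le1}(A)$ with these restricted operations are monads (the Giry monads).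
   Context: Foundations: constructive predicative mathematics (sets in HoTT) with function extensionality and unique choice; enumerable = merely the image of a surjection from $\mathbb{N}$. $\omega$-cpo: partial order with joins of enumerable directed subsets; $\omega$-continuous: monotone and preserving these joins. Free $\omega$-cpo completions of $\omega$-cpo presentations are assumed to exist; $\mathbb{S}$ is the free $\omega$-cpo over $\{\bot\le\top\}$ (a $\sigma$-frame). $\mathbb{R}_l^+$: lower reals $L:\mathbb{Q}\to\mathbb{S}$ (inhabited, rounded, lower) containing all negative rationals, ordered by inclusion, with addition $q\in L_1+L_2$ iff merely $q=q_1+q_2$, $q_i\in L_i$. Function sets into $\mathbb{R}_l^+$ carry pointwise order and addition. $r:\mathbb{S}\to\mathbb{R}_l^+$ is the unique $\omega$-continuous map with $r(\bot)=\underline 0$, $r(\top)=\underline 1$ ($\underline q=\{p\mid p<q\}$); for $U:A\to\mathbb{S}$, $\mathds{1}_U=r\circ U$. A lower integral on $A$ is an $\omega$-continuous $\mathcal{I}:(A\to\mathbb{R}_l^+)\to\mathbb{R}_l^+$ with $\mathcal{I}(0)=0$ and $\mathcal{I}(f+g)=\mathcal{I}(f)+\mathcal{I}(g)$; sub-probability if $\mathcal{I}(\mathds{1}_A)\le 1$. $\mathfrak{G}(A)$, $\mathfrak{G}_{\le1}(A)$: sets of (sub-probability) lower integrals on $A$. -}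

module Defs where

open import Data.Nat using (ℕ)
open import Data.Rational using (ℚ; _<_; _≤_; _+_; 0ℚ; 1ℚ; _<?_)
open import Data.Rational.Properties as ℚP using ()
open import Data.Product using (Σ; _×_; _,_; proj₁; proj₂)
open import Data.Empty using (⊥-elim)
open import Relation.Nullary using (¬_; Dec; yes; no)
open import Relation.Nullary.Decidable using (toWitness)
open import Relation.Binary.PropositionalEquality using (_≡_; refl; subst; sym)
open import Function using (_∘_)

-- Generic order-theoretic notions (ω-cpos via ℕ-enumerated directed
-- families; the carrier's equality is taken to be x ≈ y := x ⊑ y × y ⊑ x)

module _ {X : Set} (_⊑_ : X → X → Set) where

  Directed : (ℕ → X) → Set
  Directed s = ∀ i j → Σ ℕ λ k → s i ⊑ s k × s j ⊑ s k

  IsLub : (ℕ → X) → X → Set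
  IsLub s u = (∀ n → s n ⊑ u) × (∀ v → (∀ n → s n ⊑ v) → u ⊑ v)

module _ {X Y : Set} (_⊑X_ : X → X → Set) (_⊑Y_ : Y → Y → Set) where

  Monotone : (X → Y) → Set
  Monotone h = ∀ {x y} → x ⊑X y → h x ⊑Y h y

  ωContinuous : (X → Y) → Set
  ωContinuous h =
    Monotone h ×
    (∀ (s : ℕ → X) → Directed _⊑X_ s → ∀ u → IsLub _⊑X_ s u →
       IsLub _⊑Y_ (h ∘ s) (h u))

record ωCPO : Set₁ where
  field
    Carrier : Set
    _⊑_ : Carrier → Carrier → Set
    ⊑-refl : ∀ {x} → x ⊑ x
    ⊑-trans : ∀ {x y z} → x ⊑ y → y ⊑ z → x ⊑ z
    ⋁ : (s : ℕ → Carrier) → Directed _⊑_ s → Carrier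
    ⋁-lub : ∀ s (d : Directed _⊑_ s) → IsLub _⊑_ s (⋁ s d)

  infix 4 _≈_
  _≈_ : Carrier → Carrier → Set
  x ≈ y = (x ⊑ y) × (y ⊑ x)

-- 𝕊 : the free ω-cpo over the two-element poset {⊥ ≤ ⊤}.
-- Since the paper only assumes that free completions exist, we take 𝕊
-- as an arbitrary structure with this universal property.

record Sierpinski : Set₁ where
  field
    cpo : ωCPO
  open ωCPO cpo public
  field
    ⊥ₛ ⊤ₛ : Carrier
    ⊥⊑⊤ : ⊥ₛ ⊑ ⊤ₛ
    extend : (D : ωCPO) (d₀ d₁ : ωCPO.Carrier D) → ωCPO._⊑_ D d₀ d₁ →
             Carrier → ωCPO.Carrier D
    extend-cont : ∀ D d₀ d₁ (p : ωCPO._⊑_ D d₀ d₁) →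
                  ωContinuous _⊑_ (ωCPO._⊑_ D) (extend D d₀ d₁ p)
    extend-⊥ : ∀ D d₀ d₁ (p : ωCPO._⊑_ D d₀ d₁) →
               ωCPO._≈_ D (extend D d₀ d₁ p ⊥ₛ) d₀
    extend-⊤ : ∀ D d₀ d₁ (p : ωCPO._⊑_ D d₀ d₁) →
               ωCPO._≈_ D (extend D d₀ d₁ p ⊤ₛ) d₁
    extend-unique : ∀ D d₀ d₁ (p : ωCPO._⊑_ D d₀ d₁)
                    (h : Carrier → ωCPO.Carrier D) →
                    ωContinuous _⊑_ (ωCPO._⊑_ D) h →
                    ωCPO._≈_ D (h ⊥ₛ) d₀ → ωCPO._≈_ D (h ⊤ₛ) d₁ →
                    ∀ x → ωCPO._≈_ D (h x) (extend D d₀ d₁ p x)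

module Giry (S : Sierpinski) where
  open Sierpinski S

  infix 1 _⇔_
  infix 4 _∈_ _≤ᴿ_ _≈ᴿ_
  _⇔_ : Set → Set → Set
  P ⇔ Q = (P → Q) × (Q → P)

  record ℝₗ⁺ : Set where
    constructor mkℝ
    field
      L : ℚ → Carrier
      inhabited : Σ ℚ λ q → L q ≈ ⊤ₛ
      rounded : ∀ q → L q ≈ ⊤ₛ ⇔ (Σ ℚ λ p → q < p × L p ≈ ⊤ₛ)
      lower : ∀ p q → p ≤ q → L q ≈ ⊤ₛ → L p ≈ ⊤ₛ
      negatives : ∀ q → q < 0ℚ → L q ≈ ⊤ₛ

  _∈_ : ℚ → ℝₗ⁺ → Set
  q ∈ x = ℝₗ⁺.L x q ≈ ⊤ₛ

  _≤ᴿ_ : ℝₗ⁺ → ℝₗ⁺ → Set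
  x ≤ᴿ y = ∀ q → q ∈ x → q ∈ y

  _≈ᴿ_ : ℝₗ⁺ → ℝₗ⁺ → Set
  x ≈ᴿ y = (x ≤ᴿ y) × (y ≤ᴿ x)

  IsSum : ℝₗ⁺ → ℝₗ⁺ → ℝₗ⁺ → Set
  IsSum x y z = ∀ q → q ∈ z ⇔
    (Σ ℚ λ q₁ → Σ ℚ λ q₂ → (q ≡ q₁ + q₂) × q₁ ∈ x × q₂ ∈ y)

  χ : {P : Set} → Dec P → Carrier
  χ (yes _) = ⊤ₛ
  χ (no _) = ⊥ₛ

  private
    ⊤≈⊤ : ⊤ₛ ≈ ⊤ₛ
    ⊤≈⊤ = ⊑-refl , ⊑-refl

    mem-lower : ∀ q p p' → p ≤ p' → χ (p' <? q) ≈ ⊤ₛ → χ (p <? q) ≈ ⊤ₛ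
    mem-lower q p p' p≤p' m with p <? q | p' <? q
    ... | yes _ | _ = ⊤≈⊤
    ... | no _ | no _ = m
    ... | no ¬p<q | yes p'<q = ⊥-elim (¬p<q (ℚP.≤-<-trans p≤p' p'<q))

    0<1 : 0ℚ < 1ℚ
    0<1 = toWitness {a? = 0ℚ <? 1ℚ} _

    p<p+1 : ∀ p → p < p + 1ℚ
    p<p+1 p = subst (_< p + 1ℚ) (ℚP.+-identityʳ p) (ℚP.+-monoʳ-< p 0<1)

    mem-yes : ∀ q p → p < q → χ (p <? q) ≈ ⊤ₛ
    mem-yes q p p<q with p <? q
    ... | yes _ = ⊤≈⊤
    ... | no ¬p<q = ⊥-elim (¬p<q p<q)

    ⊥-mem : ∀ q p → ⊥ₛ ≈ ⊤ₛ → χ (p <? q) ≈ ⊤ₛ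
    ⊥-mem q p b with p <? q
    ... | yes _ = ⊤≈⊤
    ... | no _ = b

    mem-round : ∀ q p → χ (p <? q) ≈ ⊤ₛ → Σ ℚ λ p' → p < p' × χ (p' <? q) ≈ ⊤ₛ
    mem-round q p m with p <? q
    ... | yes p<q = let (m' , p<m' , m'<q) = ℚP.<-dense p<q in
                    m' , p<m' , mem-yes q m' m'<q
    ... | no _ = p + 1ℚ , p<p+1 p , ⊥-mem q (p + 1ℚ) m

    -1ℚ : ℚ
    -1ℚ = Data.Rational.-_ 1ℚ

    -1<0 : -1ℚ < 0ℚ
    -1<0 = toWitness {a? = -1ℚ <? 0ℚ} _

  const : (q : ℚ) → 0ℚ ≤ q → ℝₗ⁺
  const q 0≤q = mkℝ
    (λ p → χ (p <? q))
    (-1ℚ , mem-yes q -1ℚ (ℚP.<-≤-trans -1<0 0≤q))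
    (λ p → mem-round q p ,
           λ { (p' , p<p' , m) → mem-lower q p p' (ℚP.<⇒≤ p<p') m })
    (mem-lower q)
    (λ p p<0 → mem-yes q p (ℚP.<-≤-trans p<0 0≤q))

  0ᴿ : ℝₗ⁺
  0ᴿ = const 0ℚ ℚP.≤-refl

  1ᴿ : ℝₗ⁺
  1ᴿ = const 1ℚ (ℚP.<⇒≤ 0<1)

  -- r(⊤) = 1̲ ; hence 𝟙_A = r ∘ (λ _ → ⊤) is the constant function 1̲
  𝟙 : (A : Set) → A → ℝₗ⁺
  𝟙 A _ = 1ᴿ

  _≤ᶠ_ : {A : Set} → (A → ℝₗ⁺) → (A → ℝₗ⁺) → Set
  f ≤ᶠ g = ∀ a → f a ≤ᴿ g a

  -- The ω-cpo A → ℝₗ⁺ carries the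
  -- pointwise order, and its joins of directed families are computed
  -- pointwise; we state "I preserves joins" as: I maps the (pointwise)
  -- join of a directed family to the join of the image family.
  ωContinuousᴵ : {A : Set} → ((A → ℝₗ⁺) → ℝₗ⁺) → Set
  ωContinuousᴵ {A} I =
    Monotone (_≤ᶠ_ {A}) _≤ᴿ_ I ×
    (∀ (s : ℕ → A → ℝₗ⁺) → Directed (_≤ᶠ_ {A}) s →
       ∀ (u : A → ℝₗ⁺) → (∀ a → IsLub _≤ᴿ_ (λ n → s n a) (u a)) →
       IsLub _≤ᴿ_ (I ∘ s) (I u))

  IsLowerIntegral : (A : Set) → ((A → ℝₗ⁺) → ℝₗ⁺) → Set
  IsLowerIntegral A I =
    ωContinuousᴵ {A} I ×
    (I (λ _ → 0ᴿ) ≈ᴿ 0ᴿ) ×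
    (∀ f g h → (∀ a → IsSum (f a) (g a) (h a)) → IsSum (I f) (I g) (I h))

  IsSubProbLowerIntegral : (A : Set) → ((A → ℝₗ⁺) → ℝₗ⁺) → Set
  IsSubProbLowerIntegral A I = IsLowerIntegral A I × (I (𝟙 A) ≤ᴿ 1ᴿ)

  Cont : Set → Set
  Cont A = (A → ℝₗ⁺) → ℝₗ⁺

  η : {A : Set} → A → Cont A
  η a f = f a

  _>>=_ : {A B : Set} → Cont A → (A → Cont B) → Cont B
  (x >>= y) f = x (λ a → y a f)

{-# OPTIONS --safe #-}
-- Each defining property of I >>= J (monotonicity, ω-continuity, strictness,
-- additivity) is the same property of I applied to the A-indexed family
-- a ↦ J a f, which inherits it pointwise from the J a; the monad laws hold
-- definitionally, as in any continuation monad.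
module Submission where

open import Defs
open import Data.Nat using (ℕ)
open import Data.Product using (_×_; _,_; proj₁; proj₂)
open import Function using (_∘_)

module GiryMonad (S : Sierpinski) where
  open Giry S

  ≤ᴿ-refl : ∀ x → x ≤ᴿ x
  ≤ᴿ-refl x q q∈x = q∈x

  -- x ≤ᴿ y unfolds to a Π-type from which x and y cannot be recovered by
  -- unification, so the uses below pass x, y and z explicitly.
  ≤ᴿ-trans : ∀ {x y z} → x ≤ᴿ y → y ≤ᴿ z → x ≤ᴿ z
  ≤ᴿ-trans x≤y y≤z q = y≤z q ∘ x≤y q

  ≈ᴿ-refl : ∀ x → x ≈ᴿ x
  ≈ᴿ-refl x = ≤ᴿ-refl x , ≤ᴿ-refl x

  module LowerIntegral {A : Set} {I : Cont A} (isLI : IsLowerIntegral A I) where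

    monotone : Monotone (_≤ᶠ_ {A}) _≤ᴿ_ I
    monotone = proj₁ (proj₁ isLI)

    preservesLub : ∀ (s : ℕ → A → ℝₗ⁺) → Directed (_≤ᶠ_ {A}) s →
                   ∀ u → (∀ a → IsLub _≤ᴿ_ (λ n → s n a) (u a)) →
                   IsLub _≤ᴿ_ (I ∘ s) (I u)
    preservesLub = proj₂ (proj₁ isLI)

    preservesZero : I (λ _ → 0ᴿ) ≈ᴿ 0ᴿ
    preservesZero = proj₁ (proj₂ isLI)

    additive : ∀ f g h → (∀ a → IsSum (f a) (g a) (h a)) → IsSum (I f) (I g) (I h)
    additive = proj₂ (proj₂ isLI)

  η-isLowerIntegral : ∀ {A} (a : A) → IsLowerIntegral A (η a)
  η-isLowerIntegral a =
    ((λ f≤g → f≤g a) , (λ s _ u u-lub → u-lub a)) , ≈ᴿ-refl 0ᴿ , (λ f g h sum → sum a)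

  η-isSubProbLowerIntegral : ∀ {A} (a : A) → IsSubProbLowerIntegral A (η a)
  η-isSubProbLowerIntegral a = η-isLowerIntegral a , ≤ᴿ-refl 1ᴿ

  subProb⇒lowerIntegral : ∀ {A} {I : Cont A} →
                          IsSubProbLowerIntegral A I → IsLowerIntegral A I
  subProb⇒lowerIntegral = proj₁

  directed-map : ∀ {X Y : Set} (_⊑X_ : X → X → Set) (_⊑Y_ : Y → Y → Set)
                 {h : X → Y} → Monotone _⊑X_ _⊑Y_ h →
                 ∀ {s} → Directed _⊑X_ s → Directed _⊑Y_ (h ∘ s)
  directed-map _ _ h-mono s-dir i j =
    let k , sᵢ⊑sₖ , sⱼ⊑sₖ = s-dir i j in k , h-mono sᵢ⊑sₖ , h-mono sⱼ⊑sₖ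

  module _ {A B : Set} {I : Cont A} {J : A → Cont B}
           (I-isLI : IsLowerIntegral A I)
           (J-isLI : ∀ a → IsLowerIntegral B (J a)) where

    open LowerIntegral {A} {I} I-isLI
    module Jₐ a = LowerIntegral {B} {J a} (J-isLI a)

    >>=-monotone : Monotone (_≤ᶠ_ {B}) _≤ᴿ_ (I >>= J)
    >>=-monotone f≤g = monotone (λ a → Jₐ.monotone a f≤g)

    -- The family n ↦ (a ↦ J a (s n)) is directed, and its pointwise join
    -- is a ↦ J a u since each J a is ω-continuous; now apply I.
    >>=-preservesLub : ∀ (s : ℕ → B → ℝₗ⁺) → Directed (_≤ᶠ_ {B}) s →
                       ∀ u → (∀ b → IsLub _≤ᴿ_ (λ n → s n b) (u b)) →
                       IsLub _≤ᴿ_ ((I >>= J) ∘ s) ((I >>= J) u)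
    >>=-preservesLub s s-dir u u-lub =
      preservesLub (λ n a → J a (s n))
        (directed-map _≤ᶠ_ _≤ᶠ_ {h = λ f a → J a f} (λ f≤g a → Jₐ.monotone a f≤g) s-dir)
        (λ a → J a u)
        (λ a → Jₐ.preservesLub a s s-dir u u-lub)

    >>=-preservesZero : (I >>= J) (λ _ → 0ᴿ) ≈ᴿ 0ᴿ
    >>=-preservesZero =
        ≤ᴿ-trans {(I >>= J) (λ _ → 0ᴿ)} {I (λ _ → 0ᴿ)} {0ᴿ}
          (monotone (λ a → proj₁ (Jₐ.preservesZero a))) (proj₁ preservesZero)
      , ≤ᴿ-trans {0ᴿ} {I (λ _ → 0ᴿ)} {(I >>= J) (λ _ → 0ᴿ)}
          (proj₂ preservesZero) (monotone (λ a → proj₂ (Jₐ.preservesZero a)))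

    >>=-additive : ∀ f g h → (∀ b → IsSum (f b) (g b) (h b)) →
                   IsSum ((I >>= J) f) ((I >>= J) g) ((I >>= J) h)
    >>=-additive f g h sum = additive _ _ _ (λ a → Jₐ.additive a f g h sum)

    >>=-isLowerIntegral : IsLowerIntegral B (I >>= J)
    >>=-isLowerIntegral =
      (>>=-monotone , >>=-preservesLub) , >>=-preservesZero , >>=-additive

  -- Since J a (𝟙 B) ≤ 1 = 𝟙 A a, monotonicity of I gives (I >>= J) (𝟙 B) ≤ I (𝟙 A) ≤ 1.
  >>=-isSubProbLowerIntegral : ∀ {A B} {I : Cont A} {J : A → Cont B} →
                               IsSubProbLowerIntegral A I →
                               (∀ a → IsSubProbLowerIntegral B (J a)) →
                               IsSubProbLowerIntegral B (I >>= J)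
  >>=-isSubProbLowerIntegral {A} {B} {I} {J} (I-isLI , I≤1) J-isSub =
      >>=-isLowerIntegral {A} {B} {I} {J} I-isLI (proj₁ ∘ J-isSub)
    , ≤ᴿ-trans {(I >>= J) (𝟙 B)} {I (𝟙 A)} {1ᴿ}
        (LowerIntegral.monotone {A} {I} I-isLI (proj₂ ∘ J-isSub)) I≤1

  >>=-identityˡ : ∀ {A B} (a : A) (J : A → Cont B) f → (η a >>= J) f ≈ᴿ J a f
  >>=-identityˡ a J f = ≈ᴿ-refl (J a f)

  >>=-identityʳ : ∀ {A} (I : Cont A) f → (I >>= η) f ≈ᴿ I f
  >>=-identityʳ I f = ≈ᴿ-refl (I f)

  >>=-assoc : ∀ {A B C} (I : Cont A) (J : A → Cont B) (K : B → Cont C) f →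
              ((I >>= J) >>= K) f ≈ᴿ (I >>= (λ a → J a >>= K)) f
  >>=-assoc I J K f = ≈ᴿ-refl (I (λ a → J a (λ b → K b f)))

mainTheorem5 :
    (S : Sierpinski) → let open Giry S in
      -- η(a) ∈ 𝔊≤1(A)
      (∀ (A : Set) (a : A) → IsSubProbLowerIntegral A (η a)) ×
      -- 𝔊≤1(A) ⊆ 𝔊(A)
      (∀ (A : Set) (I : Cont A) → IsSubProbLowerIntegral A I → IsLowerIntegral A I) ×
      -- 𝔊 is closed under bind
      (∀ (A B : Set) (I : Cont A) (J : A → Cont B) →
         IsLowerIntegral A I → (∀ a → IsLowerIntegral B (J a)) →
         IsLowerIntegral B (I >>= J)) ×
      -- 𝔊≤1 is closed under bind
      (∀ (A B : Set) (I : Cont A) (J : A → Cont B) →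
         IsSubProbLowerIntegral A I → (∀ a → IsSubProbLowerIntegral B (J a)) →
         IsSubProbLowerIntegral B (I >>= J)) ×
      -- monad laws (hence 𝔊 and 𝔊≤1 with the restricted operations are monads)
      (∀ (A B : Set) (a : A) (J : A → Cont B) (f : B → ℝₗ⁺) →
         (η a >>= J) f ≈ᴿ J a f) ×
      (∀ (A : Set) (I : Cont A) (f : A → ℝₗ⁺) → (I >>= η) f ≈ᴿ I f) ×
      (∀ (A B C : Set) (I : Cont A) (J : A → Cont B) (K : B → Cont C)
         (f : C → ℝₗ⁺) →
         ((I >>= J) >>= K) f ≈ᴿ (I >>= (λ a → J a >>= K)) f)
mainTheorem5 S =
    (λ _ → η-isSubProbLowerIntegral)
  , (λ A I → subProb⇒lowerIntegral {A} {I})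
  , (λ A B I J → >>=-isLowerIntegral {A} {B} {I} {J})
  , (λ A B I J → >>=-isSubProbLowerIntegral {A} {B} {I} {J})
  , (λ _ _ → >>=-identityˡ)
  , (λ _ → >>=-identityʳ)
  , (λ _ _ _ → >>=-assoc)
  where open GiryMonad S
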